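{- Let $G$ be a connected graph of diameter $d$, and let $\mathcal{G}^k$ denote the family of all induced isometric subgraphs of $G$ of diameter $k$. Then for every $k\in\{1,2,\dots,d\}$, $$\mu_k(G)\ge \max\{\mu(H)\,:\,H\in\mathcal{G}^k\}.$$
   Context: All graphs are finite, simple, undirected and connected. For a graph $G$, a set $S\subseteq V(G)$ and an integer $k\ge 1$, two vertices $x,y$ are $S_k$-visible if there is a shortest $x,y$-path of length at most $k$ none of whose internal vertices lies in $S$. $S$ is a $k$-distance mutual-visibility set if every two vertices of $S$ are $S_k$-visible, and $\mu_k(G)$ is the maximum cardinality of such a set. Two vertices $x,y\in S$ are $S$-visible if there is a shortest $x,y$-path $P$ with $V(P)\cap S=\{x,y\}$; $S$ is a mutual-visibility set if every two vertices of $S$ are $S$-visible, and $\mu(G)$ (the mutual-visibility number) is the maximum cardinality of such a set. A subgraph $H$ of $G$ is isometric if $d_H(u,v)=d_G(u,v)$ for all $u,v\in V(H)$. -}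

module Defs where

open import Data.Nat using (ℕ; zero; suc; _≤_)
open import Data.Bool using (Bool; true; false; T)
open import Data.Fin using (Fin)
open import Data.Fin.Subset using (Subset; _∈_; _∉_; ∣_∣)
open import Data.List using (List; []; _∷_)
open import Data.List.Relation.Unary.All using (All)
open import Data.Product using (Σ; ∃; _×_; _,_)
open import Function.Definitions using (Injective)
open import Relation.Binary.PropositionalEquality using (_≡_)

record Graph (n : ℕ) : Set where
  field
    adj   : Fin n → Fin n → Bool
    sym   : ∀ x y → adj x y ≡ adj y x
    irrefl : ∀ x → adj x x ≡ false
open Graph public

Edge : ∀ {n} → Graph n → Fin n → Fin n → Set
Edge G x y = T (adj G x y)

data Walk {n} (G : Graph n) : Fin n → Fin n → ℕ → Set where
  here : ∀ {x} → Walk G x x zero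
  step : ∀ {x y z ℓ} → Edge G x y → Walk G y z ℓ → Walk G x z (suc ℓ)

nonLast : ∀ {n} {G : Graph n} {x y ℓ} → Walk G x y ℓ → List (Fin n)
nonLast here = []
nonLast (step {x = x} e w) = x ∷ nonLast w

-- internal vertices of a walk (all except the two end vertices)
inner : ∀ {n} {G : Graph n} {x y ℓ} → Walk G x y ℓ → List (Fin n)
inner here = []
inner (step e w) = nonLast w

Dist : ∀ {n} → Graph n → Fin n → Fin n → ℕ → Set
Dist G x y m = Walk G x y m × (∀ ℓ → Walk G x y ℓ → m ≤ ℓ)

Connected : ∀ {n} → Graph n → Set
Connected G = ∀ x y → ∃ λ ℓ → Walk G x y ℓ

Diameter : ∀ {n} → Graph n → ℕ → Set
Diameter {n} G d =
  (∀ x y m → Dist G x y m → m ≤ d) × Σ (Fin n) λ x → Σ (Fin n) λ y → Dist G x y d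

Visible : ∀ {n} → Graph n → Subset n → Fin n → Fin n → Set
Visible G S x y =
  ∃ λ m → Dist G x y m × Σ (Walk G x y m) λ w → All (_∉ S) (inner w)

VisibleK : ∀ {n} → Graph n → ℕ → Subset n → Fin n → Fin n → Set
VisibleK G k S x y =
  ∃ λ m → m ≤ k × Dist G x y m × Σ (Walk G x y m) λ w → All (_∉ S) (inner w)

MutualVis : ∀ {n} → Graph n → Subset n → Set
MutualVis G S = ∀ x y → x ∈ S → y ∈ S → Visible G S x y

KDistMutualVis : ∀ {n} → Graph n → ℕ → Subset n → Set
KDistMutualVis G k S = ∀ x y → x ∈ S → y ∈ S → VisibleK G k S x y

IsMu : ∀ {n} → Graph n → ℕ → Set
IsMu G m = (Σ _ λ S → MutualVis G S × ∣ S ∣ ≡ m)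
         × (∀ S → MutualVis G S → ∣ S ∣ ≤ m)

IsMuK : ∀ {n} → Graph n → ℕ → ℕ → Set
IsMuK G k m = (Σ _ λ S → KDistMutualVis G k S × ∣ S ∣ ≡ m)
            × (∀ S → KDistMutualVis G k S → ∣ S ∣ ≤ m)

-- H (on Fin m) is (isomorphic to) an induced isometric subgraph of G
InducedIsometric : ∀ {n m} → Graph n → Graph m → Set
InducedIsometric {n} {m} G H =
  Connected H ×
  Σ (Fin m → Fin n) λ f →
    Injective _≡_ _≡_ f
    × (∀ i j → adj H i j ≡ adj G (f i) (f j))
    × (∀ i j ℓ → Dist H i j ℓ → Dist G (f i) (f j) ℓ)

{-# OPTIONS --safe #-}
-- An isometric embedding f : H → G maps shortest paths of H to shortest paths of G of
-- the same length. So for a mutual-visibility set S of H, any two vertices of f(S) see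
-- each other along the image of a shortest path of H avoiding S, whose length is at most
-- diam H = k; as f is injective, f(S) is a k-distance mutual-visibility set of G of
-- size ∣S∣.
module Submission where

open import Defs hiding (sym)
open import Data.Nat using (ℕ; _≤_; z≤n; s≤s)
open import Data.Nat.Properties using (≤-trans)
open import Data.Bool using (T)
open import Data.Fin using (Fin; zero; suc)
open import Data.Fin.Properties using (suc-injective)
open import Data.Fin.Subset using (Subset; _∈_; _∉_; ∣_∣; ⊥; ⁅_⁆; _∪_; inside; outside)
open import Data.Fin.Subset.Properties
  using (∉⊥; x∈⁅x⁆; x∈⁅y⁆⇒x≡y; x∈p∪q⁺; x∈p∪q⁻; q⊆p∪q; p⊂q⇒∣p∣<∣q∣)
open import Data.Vec using (_∷_; []; here; there)
open import Data.List using (_∷_; map)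
open import Data.List.Relation.Unary.All using (All)
import Data.List.Relation.Unary.All as All
open import Data.List.Relation.Unary.All.Properties using (map⁺)
open import Data.Product using (∃; _×_; _,_)
open import Data.Sum using (inj₁; inj₂)
open import Data.Empty using (⊥-elim)
open import Function using (_∘_)
open import Function.Definitions using (Injective)
open import Relation.Binary.PropositionalEquality using (_≡_; refl; sym; cong; subst)

image : ∀ {m n} → (Fin m → Fin n) → Subset m → Subset n
image f []            = ⊥
image f (inside ∷ S)  = ⁅ f zero ⁆ ∪ image (f ∘ suc) S
image f (outside ∷ S) = image (f ∘ suc) S

∈-image⁺ : ∀ {m n} (f : Fin m → Fin n) (S : Subset m) {i} → i ∈ S → f i ∈ image f S
∈-image⁺ f (inside ∷ S)  here      = x∈p∪q⁺ (inj₁ (x∈⁅x⁆ (f zero)))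
∈-image⁺ f (inside ∷ S)  (there p) = x∈p∪q⁺ (inj₂ (∈-image⁺ (f ∘ suc) S p))
∈-image⁺ f (outside ∷ S) (there p) = ∈-image⁺ (f ∘ suc) S p

∈-image⁻ : ∀ {m n} (f : Fin m → Fin n) (S : Subset m) {y} →
           y ∈ image f S → ∃ λ i → i ∈ S × f i ≡ y
∈-image⁻ f [] p = ⊥-elim (∉⊥ p)
∈-image⁻ f (inside ∷ S) p with x∈p∪q⁻ ⁅ f zero ⁆ (image (f ∘ suc) S) p
... | inj₁ q = zero , here , sym (x∈⁅y⁆⇒x≡y (f zero) q)
... | inj₂ q with ∈-image⁻ (f ∘ suc) S q
...   | i , i∈S , fi≡y = suc i , there i∈S , fi≡y
∈-image⁻ f (outside ∷ S) p with ∈-image⁻ (f ∘ suc) S p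
... | i , i∈S , fi≡y = suc i , there i∈S , fi≡y

∉-image : ∀ {m n} {f : Fin m → Fin n} → Injective _≡_ _≡_ f →
          ∀ S {i} → i ∉ S → f i ∉ image f S
∉-image f-inj S i∉S fi∈ with ∈-image⁻ _ S fi∈
... | j , j∈S , fj≡fi with f-inj fj≡fi
...   | refl = i∉S j∈S

∣S∣≤∣image∣ : ∀ {m n} {f : Fin m → Fin n} → Injective _≡_ _≡_ f →
              ∀ S → ∣ S ∣ ≤ ∣ image f S ∣
∣S∣≤∣image∣ f-inj [] = z≤n
∣S∣≤∣image∣ f-inj (outside ∷ S) = ∣S∣≤∣image∣ (suc-injective ∘ f-inj) S
∣S∣≤∣image∣ {f = f} f-inj (inside ∷ S) =
  ≤-trans (s≤s (∣S∣≤∣image∣ (suc-injective ∘ f-inj) S))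
          (p⊂q⇒∣p∣<∣q∣ (q⊆p∪q _ rest , f zero , x∈p∪q⁺ (inj₁ (x∈⁅x⁆ (f zero))) , f0∉rest))
  where
  rest : Subset _
  rest = image (f ∘ suc) S

  f0∉rest : f zero ∉ rest
  f0∉rest p with ∈-image⁻ (f ∘ suc) S p
  ... | _ , _ , fsuci≡f0 with f-inj fsuci≡f0
  ...   | ()

module _ {n m} {G : Graph n} {H : Graph m} (f : Fin m → Fin n)
         (f-edge : ∀ {i j} → Edge H i j → Edge G (f i) (f j)) where

  map-Walk : ∀ {i j ℓ} → Walk H i j ℓ → Walk G (f i) (f j) ℓ
  map-Walk here       = here
  map-Walk (step e w) = step (f-edge e) (map-Walk w)

  nonLast-map-Walk : ∀ {i j ℓ} (w : Walk H i j ℓ) → nonLast (map-Walk w) ≡ map f (nonLast w)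
  nonLast-map-Walk here       = refl
  nonLast-map-Walk (step e w) = cong (f _ ∷_) (nonLast-map-Walk w)

  inner-map-Walk : ∀ {i j ℓ} (w : Walk H i j ℓ) → inner (map-Walk w) ≡ map f (inner w)
  inner-map-Walk here       = refl
  inner-map-Walk (step e w) = nonLast-map-Walk w

module _ {n m} {G : Graph n} {H : Graph m} {f : Fin m → Fin n}
         (f-inj : Injective _≡_ _≡_ f)
         (f-edge : ∀ {i j} → Edge H i j → Edge G (f i) (f j))
         (f-dist : ∀ i j ℓ → Dist H i j ℓ → Dist G (f i) (f j) ℓ)
         {k : ℕ} (dist-H≤k : ∀ i j ℓ → Dist H i j ℓ → ℓ ≤ k) where

  Visible⇒VisibleK-image : ∀ S {i j} → Visible H S i j → VisibleK G k (image f S) (f i) (f j)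
  Visible⇒VisibleK-image S {i} {j} (ℓ , dist , w , inner∉S) =
    ℓ , dist-H≤k i j ℓ dist , f-dist i j ℓ dist , map-Walk f f-edge w ,
    subst (All (_∉ image f S)) (sym (inner-map-Walk f f-edge w))
          (map⁺ (All.map (∉-image f-inj S) inner∉S))

  MutualVis⇒KDistMutualVis-image : ∀ S → MutualVis H S → KDistMutualVis G k (image f S)
  MutualVis⇒KDistMutualVis-image S S-mv x y x∈ y∈ with ∈-image⁻ f S x∈ | ∈-image⁻ f S y∈
  ... | i , i∈S , refl | j , j∈S , refl = Visible⇒VisibleK-image S (S-mv i j i∈S j∈S)

theorem2p1 : ∀ {n} (G : Graph n) → Connected G → ∀ d → Diameter G d →
    ∀ k → 1 ≤ k → k ≤ d →
    ∀ {m} (H : Graph m) → InducedIsometric G H → Diameter H k →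
    ∀ a b → IsMuK G k a → IsMu H b → b ≤ a
theorem2p1 G _ _ _ k _ _ H (_ , f , f-inj , adj≡ , f-dist) (dist-H≤k , _) a b
           (_ , μk-max) ((S , S-mv , ∣S∣≡b) , _) =
  subst (_≤ a) ∣S∣≡b (≤-trans (∣S∣≤∣image∣ f-inj S) (μk-max (image f S) image-kmv))
  where
  f-edge : ∀ {i j} → Edge H i j → Edge G (f i) (f j)
  f-edge {i} {j} = subst T (adj≡ i j)

  image-kmv : KDistMutualVis G k (image f S)
  image-kmv = MutualVis⇒KDistMutualVis-image f-inj f-edge f-dist dist-H≤k S S-mv
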